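{- Let $b_0 \leq b_1 \leq b_2 \leq \cdots$ be a nondecreasing sequence of nonnegative integers. For $n \geq 0$, let $f(n)$ denote the number of integer sequences $(a_0, a_1, \ldots, a_n)$ with $0 \leq a_0 \leq a_1 \leq \cdots \leq a_n$ and $a_j \leq b_j$ for all $0 \leq j \leq n$. Then the identity $$1 = (1-x)^{1 + b_0} + \sum_{n \geq 0} f(n)\, x^{n+1} (1-x)^{1+b_{n+1}}$$ holds in the ring $\mathbb{C}[[x]]$ of formal power series in $x$.
   Context: The infinite sum converges in $\mathbb{C}[[x]]$ since each term $x^{n+1}(1-x)^{1+b_{n+1}}$ has no monomials of degree less than $n+1$. -}

module Defs where

open import Data.Nat as ℕ using (ℕ; zero; suc; _∸_; _≤?_)
open import Data.Integer as ℤ using (ℤ; +_; -_)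
open import Data.List as L using (List; []; _∷_; [_]; concatMap; filter; length; upTo)
open import Data.Vec as V using (Vec; _∷ʳ_)
open import Data.List.Relation.Unary.Linked using (Linked; linked?)

boundedSeqs : (ℕ → ℕ) → (m : ℕ) → List (Vec ℕ m)
boundedSeqs b zero    = [ V.[] ]
boundedSeqs b (suc m) =
  concatMap (λ v → L.map (λ a → v ∷ʳ a) (upTo (suc (b m)))) (boundedSeqs b m)

f : (ℕ → ℕ) → ℕ → ℕ
f b n = length (filter (λ v → linked? ℕ._≤?_ (V.toList v)) (boundedSeqs b (suc n)))

PS : Set
PS = ℕ → ℤ

sumTo : ℕ → (ℕ → ℤ) → ℤ
sumTo zero    g = g zero
sumTo (suc k) g = sumTo k g ℤ.+ g (suc k)

one : PS
one zero    = + 1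
one (suc _) = + 0

X : PS
X 1 = + 1
X _ = + 0

oneMinusX : PS
oneMinusX zero          = + 1
oneMinusX 1             = - (+ 1)
oneMinusX (suc (suc _)) = + 0

_+ₚ_ : PS → PS → PS
(p +ₚ q) k = p k ℤ.+ q k

_*ₚ_ : PS → PS → PS
(p *ₚ q) k = sumTo k (λ i → p i ℤ.* q (k ∸ i))

_·ₚ_ : ℤ → PS → PS
(c ·ₚ p) k = c ℤ.* p k

_^ₚ_ : PS → ℕ → PS
p ^ₚ zero  = one
p ^ₚ suc m = p *ₚ (p ^ₚ m)

-- Sum of a family T of power series where T n has order ≥ n (no monomials
-- of degree < n; here T n has order ≥ n+1), which is the convergence condition in ℂ[[x]]:
-- the coefficient of x^k is the finite sum Σ_{n ≤ k} [x^k] T n.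
sumSeries : (ℕ → PS) → PS
sumSeries T k = sumTo k (λ n → T n k)

-- Let g N j count the sequences 0 ≤ a₀ ≤ … ≤ a_{N-1} ≤ j with a_i ≤ b_i, so that
-- f(N) = Σ_{j ≤ b_N} g N j and g (N+1) i = Σ_{j ≤ b_N, j ≤ i} g N j, and put
-- W_N = Σ_{j ≤ b_N} g N j (1-x)^j. The telescoping identity
-- (1-x)^j - (1-x)^m = x Σ_{j ≤ i < m} (1-x)^i, followed by an exchange of the two sums,
-- gives W_N = f(N) (1-x)^{1+b_{N+1}} + x W_{N+1} (this is where b_N ≤ b_{N+1} is needed),
-- and in the same way 1 = (1-x)^{1+b_0} + x W_0. Iterating, 1 is (1-x)^{1+b_0} plus the
-- first N terms of the series plus x^{N+1} W_N, and the last summand has no monomial of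
-- degree below N+1.
module Submission where

open import Defs
open import Data.Nat as ℕ using (ℕ; zero; suc; _≤_; _<_; _∸_; z≤n; s≤s; _≤?_)
import Data.Nat.Properties as ℕ
open import Data.Nat.ListAction using (sum)
open import Data.Nat.ListAction.Properties using (sum-++)
open import Data.Integer as ℤ using (ℤ; +_; -_; _+_; _*_; _-_)
import Data.Integer.Properties as ℤ
open import Data.Integer.Tactic.RingSolver using (solve-∀)
import Algebra.Properties.CommutativeSemigroup as CommutativeSemigroupProperties
open CommutativeSemigroupProperties ℤ.+-commutativeSemigroup using (interchange)
open import Data.List using (List; []; _∷_; [_]; _++_; _∷ʳ_; map; length; filter; concatMap; upTo)
import Data.List.Properties as List
open import Data.List.Relation.Unary.Linked using (Linked; linked?; [-]; _∷_)
open import Data.Vec as Vec using (Vec)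
import Data.Vec.Properties as Vec
open import Data.Bool using (true; false; if_then_else_)
open import Data.Product as Prod using (_×_; _,_)
open import Data.Sum using (inj₁; inj₂)
open import Function using (_∘_)
open import Relation.Binary.PropositionalEquality hiding ([_])
open import Relation.Nullary using (¬_; Dec; does; yes; no; contradiction)
open import Relation.Nullary.Decidable using (dec-true; dec-false)

∑ : ℕ → (ℕ → ℤ) → ℤ
∑ zero    g = + 0
∑ (suc n) g = ∑ n g + g n

infixl 10 ∑
syntax ∑ n (λ i → e) = ∑[ i < n ] e

∑-cong : ∀ n {g h : ℕ → ℤ} → (∀ i → i < n → g i ≡ h i) → ∑ n g ≡ ∑ n h
∑-cong zero    eq = refl
∑-cong (suc n) eq =
  cong₂ _+_ (∑-cong n (λ i i<n → eq i (ℕ.m≤n⇒m≤1+n i<n))) (eq n ℕ.≤-refl)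

∑-zero : ∀ n → ∑[ i < n ] (+ 0) ≡ + 0
∑-zero zero    = refl
∑-zero (suc n) = trans (ℤ.+-identityʳ _) (∑-zero n)

∑-distrib-+ : ∀ n (g h : ℕ → ℤ) → ∑[ i < n ] (g i + h i) ≡ ∑ n g + ∑ n h
∑-distrib-+ zero    g h = refl
∑-distrib-+ (suc n) g h =
  trans (cong (_+ (g n + h n)) (∑-distrib-+ n g h)) (interchange (∑ n g) (∑ n h) (g n) (h n))

*-distribˡ-∑ : ∀ n c (g : ℕ → ℤ) → c * ∑ n g ≡ ∑[ i < n ] (c * g i)
*-distribˡ-∑ zero    c g = ℤ.*-zeroʳ c
*-distribˡ-∑ (suc n) c g =
  trans (ℤ.*-distribˡ-+ c (∑ n g) (g n)) (cong (_+ c * g n) (*-distribˡ-∑ n c g))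

*-distribʳ-∑ : ∀ n c (g : ℕ → ℤ) → ∑ n g * c ≡ ∑[ i < n ] (g i * c)
*-distribʳ-∑ n c g = begin
  ∑ n g * c             ≡⟨ ℤ.*-comm (∑ n g) c ⟩
  c * ∑ n g             ≡⟨ *-distribˡ-∑ n c g ⟩
  ∑[ i < n ] (c * g i)  ≡⟨ ∑-cong n (λ i _ → ℤ.*-comm c (g i)) ⟩
  ∑[ i < n ] (g i * c)  ∎
  where open ≡-Reasoning

∑-comm : ∀ m n (h : ℕ → ℕ → ℤ) →
  ∑[ j < m ] ∑[ i < n ] h j i ≡ ∑[ i < n ] ∑[ j < m ] h j i
∑-comm zero    n h = sym (∑-zero n)
∑-comm (suc m) n h =
  trans (cong (_+ ∑ n (h m)) (∑-comm m n h))
        (sym (∑-distrib-+ n (λ i → ∑[ j < m ] h j i) (h m)))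

sumTo≡∑ : ∀ k g → sumTo k g ≡ ∑ (suc k) g
sumTo≡∑ zero    g = sym (ℤ.+-identityˡ (g 0))
sumTo≡∑ (suc k) g = cong (_+ g (suc k)) (sumTo≡∑ k g)

module _ {m} {g : ℕ → ℤ} (vanish : ∀ i → i ≢ m → g i ≡ + 0) where

  ∑-supported-≤ : ∀ {n} → n ≤ m → ∑ n g ≡ + 0
  ∑-supported-≤ {n} n≤m =
    trans (∑-cong n (λ i i<n → vanish i (ℕ.<⇒≢ (ℕ.<-≤-trans i<n n≤m)))) (∑-zero n)

  ∑-supported-> : ∀ {n} → m < n → ∑ n g ≡ g m
  ∑-supported-> {suc n} m<1+n with ℕ.m≤n⇒m<n∨m≡n (ℕ.≤-pred m<1+n)
  ... | inj₁ m<n  =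
    trans (cong₂ _+_ (∑-supported-> m<n) (vanish n (ℕ.>⇒≢ m<n))) (ℤ.+-identityʳ (g m))
  ... | inj₂ refl =
    trans (cong (_+ g n) (∑-supported-≤ ℕ.≤-refl)) (ℤ.+-identityˡ (g n))

shift : ℕ → PS → PS
shift zero    p k       = p k
shift (suc m) p zero    = + 0
shift (suc m) p (suc k) = shift m p k

shift-< : ∀ m p {k} → k < m → shift m p k ≡ + 0
shift-< (suc m) p {zero}  _         = refl
shift-< (suc m) p {suc k} (s≤s k<m) = shift-< m p k<m

shift-≥ : ∀ m p {k} → m ≤ k → shift m p k ≡ p (k ∸ m)
shift-≥ zero    p _         = refl
shift-≥ (suc m) p (s≤s m≤k) = shift-≥ m p m≤k

shift-cong : ∀ m {p q : PS} → (∀ k → p k ≡ q k) → ∀ k → shift m p k ≡ shift m q k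
shift-cong zero    eq k       = eq k
shift-cong (suc m) eq zero    = refl
shift-cong (suc m) eq (suc k) = shift-cong m eq k

shift-+ : ∀ m p q k → shift m (p +ₚ q) k ≡ shift m p k + shift m q k
shift-+ zero    p q k       = refl
shift-+ (suc m) p q zero    = refl
shift-+ (suc m) p q (suc k) = shift-+ m p q k

shift-· : ∀ m c p k → shift m (c ·ₚ p) k ≡ c * shift m p k
shift-· zero    c p k       = refl
shift-· (suc m) c p zero    = sym (ℤ.*-zeroʳ c)
shift-· (suc m) c p (suc k) = shift-· m c p k

shift-∑ : ∀ m n (h : ℕ → PS) k →
  shift m (λ k → ∑[ i < n ] h i k) k ≡ ∑[ i < n ] shift m (h i) k
shift-∑ zero    n h k       = refl
shift-∑ (suc m) n h zero    = sym (∑-zero n)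
shift-∑ (suc m) n h (suc k) = shift-∑ m n h k

shift-suc : ∀ m p k → shift (suc m) p k ≡ shift m (shift 1 p) k
shift-suc zero    p k       = refl
shift-suc (suc m) p zero    = refl
shift-suc (suc m) p (suc k) = shift-suc m p k

shift-1-shift : ∀ m p k → shift 1 (shift m p) k ≡ shift (suc m) p k
shift-1-shift m p zero    = refl
shift-1-shift m p (suc k) = refl

shift-one-≢ : ∀ m {k} → k ≢ m → shift m one k ≡ + 0
shift-one-≢ zero    {zero}  k≢m = contradiction refl k≢m
shift-one-≢ zero    {suc k} k≢m = refl
shift-one-≢ (suc m) {zero}  k≢m = refl
shift-one-≢ (suc m) {suc k} k≢m = shift-one-≢ m (k≢m ∘ cong suc)

shift-one-≡ : ∀ m → shift m one m ≡ + 1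
shift-one-≡ zero    = refl
shift-one-≡ (suc m) = shift-one-≡ m

∑-shift-one-* : ∀ m p k → ∑[ i < suc k ] (shift m one i * p (k ∸ i)) ≡ shift m p k
∑-shift-one-* m p k = by-cases (m ≤? k)
  where
  vanish : ∀ i → i ≢ m → shift m one i * p (k ∸ i) ≡ + 0
  vanish i i≢m = cong (_* p (k ∸ i)) (shift-one-≢ m i≢m)

  by-cases : Dec (m ≤ k) → ∑[ i < suc k ] (shift m one i * p (k ∸ i)) ≡ shift m p k
  by-cases (yes m≤k) = begin
    ∑[ i < suc k ] (shift m one i * p (k ∸ i))  ≡⟨ ∑-supported-> vanish (s≤s m≤k) ⟩
    shift m one m * p (k ∸ m)                   ≡⟨ cong (_* p (k ∸ m)) (shift-one-≡ m) ⟩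
    + 1 * p (k ∸ m)                             ≡⟨ ℤ.*-identityˡ _ ⟩
    p (k ∸ m)                                   ≡⟨ shift-≥ m p m≤k ⟨
    shift m p k                                 ∎
    where open ≡-Reasoning
  by-cases (no m≰k) =
    trans (∑-supported-≤ vanish (ℕ.≰⇒> m≰k)) (sym (shift-< m p (ℕ.≰⇒> m≰k)))

X-*ₚ : ∀ p k → (X *ₚ p) k ≡ shift 1 p k
X-*ₚ p zero    = refl
X-*ₚ p (suc k) = begin
  sumTo (suc k) (λ i → X i * p (suc k ∸ i))
    ≡⟨ sumTo≡∑ (suc k) _ ⟩
  ∑[ i < suc (suc k) ] (X i * p (suc k ∸ i))
    ≡⟨ ∑-supported-> vanish {suc (suc k)} (s≤s (s≤s z≤n)) ⟩
  + 1 * p k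
    ≡⟨ ℤ.*-identityˡ (p k) ⟩
  p k
    ∎
  where
  open ≡-Reasoning
  vanish : ∀ i → i ≢ 1 → X i * p (suc k ∸ i) ≡ + 0
  vanish zero          _   = refl
  vanish (suc zero)    i≢1 = contradiction refl i≢1
  vanish (suc (suc i)) _   = refl

X^-coeff : ∀ m k → (X ^ₚ m) k ≡ shift m one k
X^-coeff zero    k = refl
X^-coeff (suc m) k = begin
  (X *ₚ (X ^ₚ m)) k        ≡⟨ X-*ₚ (X ^ₚ m) k ⟩
  shift 1 (X ^ₚ m) k       ≡⟨ shift-cong 1 (X^-coeff m) k ⟩
  shift 1 (shift m one) k  ≡⟨ shift-1-shift m one k ⟩
  shift (suc m) one k      ∎
  where open ≡-Reasoning

X^-*ₚ : ∀ m p k → ((X ^ₚ m) *ₚ p) k ≡ shift m p k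
X^-*ₚ m p k = begin
  sumTo k (λ i → (X ^ₚ m) i * p (k ∸ i))
    ≡⟨ sumTo≡∑ k _ ⟩
  ∑[ i < suc k ] ((X ^ₚ m) i * p (k ∸ i))
    ≡⟨ ∑-cong (suc k) (λ i _ → cong (_* p (k ∸ i)) (X^-coeff m i)) ⟩
  ∑[ i < suc k ] (shift m one i * p (k ∸ i))
    ≡⟨ ∑-shift-one-* m p k ⟩
  shift m p k
    ∎
  where open ≡-Reasoning

𝟙 : ∀ {p} {P : Set p} → Dec P → ℕ
𝟙 P? = if does P? then 1 else 0

𝟙-yes : ∀ {p} {P : Set p} (P? : Dec P) → P → 𝟙 P? ≡ 1
𝟙-yes P? p = cong (if_then 1 else 0) (dec-true P? p)

𝟙-no : ∀ {p} {P : Set p} (P? : Dec P) → ¬ P → 𝟙 P? ≡ 0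
𝟙-no P? ¬p = cong (if_then 1 else 0) (dec-false P? ¬p)

oneMinusX^ : ℕ → PS
oneMinusX^ j = oneMinusX ^ₚ j

oneMinusX^-suc : ∀ j k → oneMinusX^ (suc j) k ≡ oneMinusX^ j k - shift 1 (oneMinusX^ j) k
oneMinusX^-suc j zero    = trans (ℤ.*-identityˡ _) (sym (ℤ.+-identityʳ _))
oneMinusX^-suc j (suc k) =
  trans (first-two k)
        (cong₂ _+_ (ℤ.*-identityˡ (oneMinusX^ j (suc k))) (ℤ.-1*i≡-i (oneMinusX^ j k)))
  where
  first-two : ∀ n → sumTo (suc n) (λ i → oneMinusX i * oneMinusX^ j (suc k ∸ i))
                  ≡ + 1 * oneMinusX^ j (suc k) + - (+ 1) * oneMinusX^ j k
  first-two zero    = refl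
  first-two (suc n) = trans (cong (_+ + 0) (first-two n)) (ℤ.+-identityʳ _)

oneMinusX^-telescope : ∀ {j n} k → j ≤ n →
  oneMinusX^ j k - oneMinusX^ n k ≡ ∑[ i < n ] (+ 𝟙 (j ≤? i) * shift 1 (oneMinusX^ i) k)
oneMinusX^-telescope {n = zero}  k z≤n = ℤ.+-inverseʳ (oneMinusX^ 0 k)
oneMinusX^-telescope {j} {suc n} k j≤1+n with ℕ.m≤n⇒m<n∨m≡n j≤1+n
... | inj₁ (s≤s j≤n) = begin
  d j - d (suc n)
    ≡⟨ cong (λ u → d j - u) (oneMinusX^-suc n k) ⟩
  d j - (d n - s n)
    ≡⟨ rearrange (d j) (d n) (s n) ⟩
  (d j - d n) + s n
    ≡⟨ cong₂ _+_ (oneMinusX^-telescope k j≤n) (sym (ℤ.*-identityˡ (s n))) ⟩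
  ∑[ i < n ] (t i) + + 1 * s n
    ≡⟨ cong (λ c → ∑[ i < n ] (t i) + + c * s n) (𝟙-yes (j ≤? n) j≤n) ⟨
  ∑[ i < suc n ] (t i)
    ∎
  where
  open ≡-Reasoning
  d s t : ℕ → ℤ
  d i = oneMinusX^ i k
  s i = shift 1 (oneMinusX^ i) k
  t i = + 𝟙 (j ≤? i) * s i
  rearrange : ∀ a b c → a - (b - c) ≡ (a - b) + c
  rearrange = solve-∀
... | inj₂ refl = begin
  oneMinusX^ j k - oneMinusX^ j k
    ≡⟨ ℤ.+-inverseʳ (oneMinusX^ j k) ⟩
  + 0
    ≡⟨ ∑-zero j ⟨
  ∑[ i < j ] (+ 0)
    ≡⟨ ∑-cong j (λ i i<j → cong (λ c → + c * _) (𝟙-no (j ≤? i) (ℕ.<⇒≱ i<j))) ⟨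
  ∑[ i < j ] (+ 𝟙 (j ≤? i) * shift 1 (oneMinusX^ i) k)
    ∎
  where open ≡-Reasoning

module TransferIdentity
  (b : ℕ → ℕ) (b-mono : ∀ i → b i ≤ b (suc i))
  (g : ℕ → ℕ → ℤ) (F : ℕ → ℤ)
  (g-zero : ∀ i → g 0 i ≡ + 1)
  (g-suc : ∀ N i → g (suc N) i ≡ ∑[ j < suc (b N) ] (+ 𝟙 (j ≤? i) * g N j))
  (F-∑ : ∀ N → F N ≡ ∑[ j < suc (b N) ] g N j)
  where

  W : ℕ → PS
  W N k = ∑[ j < suc (b N) ] (g N j * oneMinusX^ j k)

  term : ℕ → PS
  term n = F n ·ₚ ((X ^ₚ suc n) *ₚ oneMinusX^ (suc (b (suc n))))

  shift-1-W : ∀ N k → shift 1 (W N) k ≡ ∑[ j < suc (b N) ] (g N j * shift 1 (oneMinusX^ j) k)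
  shift-1-W N k =
    trans (shift-∑ 1 (suc (b N)) (λ j → g N j ·ₚ oneMinusX^ j) k)
          (∑-cong (suc (b N)) (λ j _ → shift-· 1 (g N j) (oneMinusX^ j) k))

  W-telescoped : ∀ N k →
    ∑[ j < suc (b N) ] (g N j * (oneMinusX^ j k - oneMinusX^ (suc (b (suc N))) k))
      ≡ shift 1 (W (suc N)) k
  W-telescoped N k = begin
    ∑[ j < M ] (g N j * (oneMinusX^ j k - oneMinusX^ M′ k))
      ≡⟨ ∑-cong M (λ j j<M → cong (g N j *_) (oneMinusX^-telescope k (j≤M′ j<M))) ⟩
    ∑[ j < M ] (g N j * ∑[ i < M′ ] (+ 𝟙 (j ≤? i) * s i))
      ≡⟨ ∑-cong M (λ j _ → *-distribˡ-∑ M′ (g N j) _) ⟩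
    ∑[ j < M ] ∑[ i < M′ ] (g N j * (+ 𝟙 (j ≤? i) * s i))
      ≡⟨ ∑-comm M M′ _ ⟩
    ∑[ i < M′ ] ∑[ j < M ] (g N j * (+ 𝟙 (j ≤? i) * s i))
      ≡⟨ ∑-cong M′ (λ i _ → ∑-cong M (λ j _ → reassoc (g N j) (+ 𝟙 (j ≤? i)) (s i))) ⟩
    ∑[ i < M′ ] ∑[ j < M ] (+ 𝟙 (j ≤? i) * g N j * s i)
      ≡⟨ ∑-cong M′ (λ i _ → *-distribʳ-∑ M (s i) _) ⟨
    ∑[ i < M′ ] (∑[ j < M ] (+ 𝟙 (j ≤? i) * g N j) * s i)
      ≡⟨ ∑-cong M′ (λ i _ → cong (_* s i) (g-suc N i)) ⟨
    ∑[ i < M′ ] (g (suc N) i * s i)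
      ≡⟨ shift-1-W (suc N) k ⟨
    shift 1 (W (suc N)) k
      ∎
    where
    open ≡-Reasoning
    M M′ : ℕ
    M  = suc (b N)
    M′ = suc (b (suc N))
    s : ℕ → ℤ
    s i = shift 1 (oneMinusX^ i) k
    j≤M′ : ∀ {j} → j < M → j ≤ M′
    j≤M′ (s≤s j≤bN) = ℕ.m≤n⇒m≤1+n (ℕ.≤-trans j≤bN (b-mono N))
    reassoc : ∀ x c y → x * (c * y) ≡ c * x * y
    reassoc = solve-∀

  W-step : ∀ N k → W N k ≡ ((F N ·ₚ oneMinusX^ (suc (b (suc N)))) +ₚ shift 1 (W (suc N))) k
  W-step N k = begin
    ∑[ j < M ] (g N j * d j)
      ≡⟨ ∑-cong M (λ j _ → split (g N j) (d j) (d M′)) ⟩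
    ∑[ j < M ] (g N j * d M′ + g N j * (d j - d M′))
      ≡⟨ ∑-distrib-+ M _ _ ⟩
    ∑[ j < M ] (g N j * d M′) + ∑[ j < M ] (g N j * (d j - d M′))
      ≡⟨ cong₂ _+_ (sym (*-distribʳ-∑ M (d M′) (g N))) (W-telescoped N k) ⟩
    ∑[ j < M ] (g N j) * d M′ + shift 1 (W (suc N)) k
      ≡⟨ cong (λ c → c * d M′ + shift 1 (W (suc N)) k) (F-∑ N) ⟨
    F N * d M′ + shift 1 (W (suc N)) k
      ∎
    where
    open ≡-Reasoning
    M M′ : ℕ
    M  = suc (b N)
    M′ = suc (b (suc N))
    d : ℕ → ℤ
    d j = oneMinusX^ j k
    split : ∀ x y z → x * y ≡ x * z + x * (y - z)
    split = solve-∀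

  one≡oneMinusX^+shift-W : ∀ k → one k ≡ oneMinusX^ (suc (b 0)) k + shift 1 (W 0) k
  one≡oneMinusX^+shift-W k = trans (split (one k) (d M)) (cong (λ t → d M + t) (begin
    d 0 - d M                        ≡⟨ oneMinusX^-telescope {n = M} k z≤n ⟩
    ∑[ i < M ] (+ 𝟙 (0 ≤? i) * s i)  ≡⟨ ∑-cong M (λ i _ → cong (_* s i) (g-zero i)) ⟨
    ∑[ i < M ] (g 0 i * s i)         ≡⟨ shift-1-W 0 k ⟨
    shift 1 (W 0) k                  ∎))
    where
    open ≡-Reasoning
    M : ℕ
    M = suc (b 0)
    d s : ℕ → ℤ
    d j = oneMinusX^ j k
    s i = shift 1 (oneMinusX^ i) k
    split : ∀ x y → x ≡ y + (x - y)
    split = solve-∀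

  shift-W≡term+shift-W : ∀ N k →
    shift (suc N) (W N) k ≡ term N k + shift (suc (suc N)) (W (suc N)) k
  shift-W≡term+shift-W N k = begin
    shift (suc N) (W N) k
      ≡⟨ shift-cong (suc N) (W-step N) k ⟩
    shift (suc N) ((F N ·ₚ oneMinusX^ M′) +ₚ shift 1 (W (suc N))) k
      ≡⟨ shift-+ (suc N) _ _ k ⟩
    shift (suc N) (F N ·ₚ oneMinusX^ M′) k + shift (suc N) (shift 1 (W (suc N))) k
      ≡⟨ cong₂ _+_ (shift-· (suc N) (F N) (oneMinusX^ M′) k) (sym (shift-suc (suc N) (W (suc N)) k)) ⟩
    F N * shift (suc N) (oneMinusX^ M′) k + shift (suc (suc N)) (W (suc N)) k
      ≡⟨ cong (λ t → F N * t + shift (suc (suc N)) (W (suc N)) k) (X^-*ₚ (suc N) (oneMinusX^ M′) k) ⟨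
    term N k + shift (suc (suc N)) (W (suc N)) k
      ∎
    where
    open ≡-Reasoning
    M′ : ℕ
    M′ = suc (b (suc N))

  one≡partialSum+remainder : ∀ N k →
    one k ≡ oneMinusX^ (suc (b 0)) k + ∑[ n < N ] (term n k) + shift (suc N) (W N) k
  one≡partialSum+remainder zero    k =
    trans (one≡oneMinusX^+shift-W k)
          (cong (_+ shift 1 (W 0) k) (sym (ℤ.+-identityʳ (oneMinusX^ (suc (b 0)) k))))
  one≡partialSum+remainder (suc N) k = begin
    one k
      ≡⟨ one≡partialSum+remainder N k ⟩
    a + ∑[ n < N ] (term n k) + shift (suc N) (W N) k
      ≡⟨ cong (λ t → a + ∑[ n < N ] (term n k) + t) (shift-W≡term+shift-W N k) ⟩
    a + ∑[ n < N ] (term n k) + (term N k + shift (suc (suc N)) (W (suc N)) k)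
      ≡⟨ reassoc a (∑[ n < N ] (term n k)) (term N k) _ ⟩
    a + ∑[ n < suc N ] (term n k) + shift (suc (suc N)) (W (suc N)) k
      ∎
    where
    open ≡-Reasoning
    a : ℤ
    a = oneMinusX^ (suc (b 0)) k
    reassoc : ∀ a s t e → a + s + (t + e) ≡ a + (s + t) + e
    reassoc = solve-∀

  identity : ∀ k → one k ≡ (oneMinusX^ (suc (b 0)) +ₚ sumSeries term) k
  identity k = begin
    one k
      ≡⟨ one≡partialSum+remainder (suc k) k ⟩
    a + ∑[ n < suc k ] (term n k) + shift (suc (suc k)) (W (suc k)) k
      ≡⟨ cong (λ t → a + ∑[ n < suc k ] (term n k) + t) (shift-< (suc (suc k)) (W (suc k)) k<2+k) ⟩
    a + ∑[ n < suc k ] (term n k) + + 0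
      ≡⟨ ℤ.+-identityʳ _ ⟩
    a + ∑[ n < suc k ] (term n k)
      ≡⟨ cong (λ t → a + t) (sumTo≡∑ k (λ n → term n k)) ⟨
    a + sumSeries term k
      ∎
    where
    open ≡-Reasoning
    a : ℤ
    a = oneMinusX^ (suc (b 0)) k
    k<2+k : k < suc (suc k)
    k<2+k = ℕ.m<n⇒m<1+n (ℕ.n<1+n k)

sum-map-+ : ∀ {A : Set} (g h : A → ℕ) xs →
  sum (map (λ x → g x ℕ.+ h x) xs) ≡ sum (map g xs) ℕ.+ sum (map h xs)
sum-map-+ g h []       = refl
sum-map-+ g h (x ∷ xs) =
  trans (cong (g x ℕ.+ h x ℕ.+_) (sum-map-+ g h xs))
        (ℕ-interchange (g x) (h x) (sum (map g xs)) (sum (map h xs)))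
  where
  open CommutativeSemigroupProperties ℕ.+-commutativeSemigroup
    renaming (interchange to ℕ-interchange)

sum-map-zero : ∀ {A : Set} (xs : List A) → sum (map (λ _ → 0) xs) ≡ 0
sum-map-zero []       = refl
sum-map-zero (x ∷ xs) = sum-map-zero xs

*-distribˡ-sum-map : ∀ {A : Set} c (g : A → ℕ) xs →
  c ℕ.* sum (map g xs) ≡ sum (map (λ x → c ℕ.* g x) xs)
*-distribˡ-sum-map c g []       = ℕ.*-zeroʳ c
*-distribˡ-sum-map c g (x ∷ xs) =
  trans (ℕ.*-distribˡ-+ c (g x) (sum (map g xs)))
        (cong (c ℕ.* g x ℕ.+_) (*-distribˡ-sum-map c g xs))

sum-map-comm : ∀ {A B : Set} (h : A → B → ℕ) xs ys →
  sum (map (λ x → sum (map (h x) ys)) xs) ≡ sum (map (λ y → sum (map (λ x → h x y) xs)) ys)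
sum-map-comm h []       ys = sym (sum-map-zero ys)
sum-map-comm h (x ∷ xs) ys =
  trans (cong (sum (map (h x) ys) ℕ.+_) (sum-map-comm h xs ys))
        (sym (sum-map-+ (h x) (λ y → sum (map (λ x → h x y) xs)) ys))

sum-map-concatMap : ∀ {A B : Set} (g : B → ℕ) (h : A → List B) xs →
  sum (map g (concatMap h xs)) ≡ sum (map (λ x → sum (map g (h x))) xs)
sum-map-concatMap g h []       = refl
sum-map-concatMap g h (x ∷ xs) = begin
  sum (map g (h x ++ concatMap h xs))
    ≡⟨ cong sum (List.map-++ g (h x) (concatMap h xs)) ⟩
  sum (map g (h x) ++ map g (concatMap h xs))
    ≡⟨ sum-++ (map g (h x)) _ ⟩
  sum (map g (h x)) ℕ.+ sum (map g (concatMap h xs))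
    ≡⟨ cong (sum (map g (h x)) ℕ.+_) (sum-map-concatMap g h xs) ⟩
  sum (map (λ x → sum (map g (h x))) (x ∷ xs))
    ∎
  where open ≡-Reasoning

sum-map-upTo : ∀ n (g : ℕ → ℕ) → + sum (map g (upTo n)) ≡ ∑[ i < n ] (+ g i)
sum-map-upTo zero    g = refl
sum-map-upTo (suc n) g = begin
  + sum (map g (upTo (suc n)))
    ≡⟨ cong (λ l → + sum (map g l)) (List.upTo-∷ʳ n) ⟨
  + sum (map g (upTo n ++ [ n ]))
    ≡⟨ cong (λ l → + sum l) (List.map-++ g (upTo n) [ n ]) ⟩
  + sum (map g (upTo n) ++ [ g n ])
    ≡⟨ cong +_ (sum-++ (map g (upTo n)) [ g n ]) ⟩
  + (sum (map g (upTo n)) ℕ.+ (g n ℕ.+ 0))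
    ≡⟨ cong (λ t → + (sum (map g (upTo n)) ℕ.+ t)) (ℕ.+-identityʳ (g n)) ⟩
  + (sum (map g (upTo n)) ℕ.+ g n)
    ≡⟨ ℤ.pos-+ (sum (map g (upTo n))) (g n) ⟩
  + sum (map g (upTo n)) + + g n
    ≡⟨ cong (_+ + g n) (sum-map-upTo n g) ⟩
  ∑[ i < suc n ] (+ g i)
    ∎
  where open ≡-Reasoning

length-filter≡sum-𝟙 : ∀ {A : Set} {P : A → Set} (P? : ∀ x → Dec (P x)) xs →
  length (filter P? xs) ≡ sum (map (λ x → 𝟙 (P? x)) xs)
length-filter≡sum-𝟙 P? []       = refl
length-filter≡sum-𝟙 P? (x ∷ xs) with does (P? x)
... | true  = cong suc (length-filter≡sum-𝟙 P? xs)
... | false = length-filter≡sum-𝟙 P? xs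

module _ {A : Set} {R : A → A → Set} where

  Linked-∷ʳ-∷ʳ⁻ : ∀ xs {a c} → Linked R ((xs ∷ʳ a) ∷ʳ c) → Linked R (xs ∷ʳ a) × R a c
  Linked-∷ʳ-∷ʳ⁻ []           (Rac ∷ [-])  = [-] , Rac
  Linked-∷ʳ-∷ʳ⁻ (x ∷ [])     (Rxa ∷ rest) = Prod.map₁ (Rxa ∷_) (Linked-∷ʳ-∷ʳ⁻ [] rest)
  Linked-∷ʳ-∷ʳ⁻ (x ∷ y ∷ xs) (Rxy ∷ rest) = Prod.map₁ (Rxy ∷_) (Linked-∷ʳ-∷ʳ⁻ (y ∷ xs) rest)

  Linked-∷ʳ-∷ʳ⁺ : ∀ xs {a c} → Linked R (xs ∷ʳ a) → R a c → Linked R ((xs ∷ʳ a) ∷ʳ c)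
  Linked-∷ʳ-∷ʳ⁺ []           _            Rac = Rac ∷ [-]
  Linked-∷ʳ-∷ʳ⁺ (x ∷ [])     (Rxa ∷ rest) Rac = Rxa ∷ Linked-∷ʳ-∷ʳ⁺ [] rest Rac
  Linked-∷ʳ-∷ʳ⁺ (x ∷ y ∷ xs) (Rxy ∷ rest) Rac = Rxy ∷ Linked-∷ʳ-∷ʳ⁺ (y ∷ xs) rest Rac

  𝟙-linked-∷ʳ-∷ʳ : (R? : ∀ x y → Dec (R x y)) → ∀ xs a c →
    𝟙 (linked? R? ((xs ∷ʳ a) ∷ʳ c)) ≡ 𝟙 (R? a c) ℕ.* 𝟙 (linked? R? (xs ∷ʳ a))
  𝟙-linked-∷ʳ-∷ʳ R? xs a c with R? a c | linked? R? (xs ∷ʳ a)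
  ... | yes Rac | yes lk = 𝟙-yes (linked? R? _) (Linked-∷ʳ-∷ʳ⁺ xs lk Rac)
  ... | yes _   | no ¬lk = 𝟙-no (linked? R? _) (¬lk ∘ Prod.proj₁ ∘ Linked-∷ʳ-∷ʳ⁻ xs)
  ... | no ¬Rac | _      = 𝟙-no (linked? R? _) (¬Rac ∘ Prod.proj₂ ∘ Linked-∷ʳ-∷ʳ⁻ xs)

ascending? : ∀ {m} (v : Vec ℕ m) → Dec (Linked _≤_ (Vec.toList v))
ascending? v = linked? _≤?_ (Vec.toList v)

cappedCount : (ℕ → ℕ) → ℕ → ℕ → ℕ
cappedCount b N j = length (filter (λ v → ascending? (v Vec.∷ʳ j)) (boundedSeqs b N))

𝟙-ascending-∷ʳ-∷ʳ : ∀ {m} (v : Vec ℕ m) a j →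
  𝟙 (ascending? ((v Vec.∷ʳ a) Vec.∷ʳ j)) ≡ 𝟙 (a ≤? j) ℕ.* 𝟙 (ascending? (v Vec.∷ʳ a))
𝟙-ascending-∷ʳ-∷ʳ v a j = begin
  𝟙 (linked? _≤?_ (Vec.toList ((v Vec.∷ʳ a) Vec.∷ʳ j)))
    ≡⟨ cong (λ l → 𝟙 (linked? _≤?_ l)) toList-∷ʳ-∷ʳ ⟩
  𝟙 (linked? _≤?_ ((Vec.toList v ∷ʳ a) ∷ʳ j))
    ≡⟨ 𝟙-linked-∷ʳ-∷ʳ _≤?_ (Vec.toList v) a j ⟩
  𝟙 (a ≤? j) ℕ.* 𝟙 (linked? _≤?_ (Vec.toList v ∷ʳ a))
    ≡⟨ cong (λ l → 𝟙 (a ≤? j) ℕ.* 𝟙 (linked? _≤?_ l)) (Vec.toList-∷ʳ a v) ⟨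
  𝟙 (a ≤? j) ℕ.* 𝟙 (ascending? (v Vec.∷ʳ a))
    ∎
  where
  open ≡-Reasoning
  toList-∷ʳ-∷ʳ : Vec.toList ((v Vec.∷ʳ a) Vec.∷ʳ j) ≡ (Vec.toList v ∷ʳ a) ∷ʳ j
  toList-∷ʳ-∷ʳ = trans (Vec.toList-∷ʳ j (v Vec.∷ʳ a)) (cong (_∷ʳ j) (Vec.toList-∷ʳ a v))

sum-map-boundedSeqs-suc : ∀ b N (h : Vec ℕ (suc N) → ℕ) →
  sum (map h (boundedSeqs b (suc N)))
    ≡ sum (map (λ a → sum (map (λ v → h (v Vec.∷ʳ a)) (boundedSeqs b N))) (upTo (suc (b N))))
sum-map-boundedSeqs-suc b N h = begin
  sum (map h (concatMap (λ v → map (v Vec.∷ʳ_) as) (boundedSeqs b N)))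
    ≡⟨ sum-map-concatMap h (λ v → map (v Vec.∷ʳ_) as) (boundedSeqs b N) ⟩
  sum (map (λ v → sum (map h (map (v Vec.∷ʳ_) as))) (boundedSeqs b N))
    ≡⟨ cong sum (List.map-cong (λ v → cong sum (sym (List.map-∘ as))) (boundedSeqs b N)) ⟩
  sum (map (λ v → sum (map (λ a → h (v Vec.∷ʳ a)) as)) (boundedSeqs b N))
    ≡⟨ sum-map-comm (λ v a → h (v Vec.∷ʳ a)) (boundedSeqs b N) as ⟩
  sum (map (λ a → sum (map (λ v → h (v Vec.∷ʳ a)) (boundedSeqs b N))) as)
    ∎
  where
  open ≡-Reasoning
  as : List ℕ
  as = upTo (suc (b N))

cappedCount≡sum-𝟙 : ∀ b N j →
  cappedCount b N j ≡ sum (map (λ v → 𝟙 (ascending? (v Vec.∷ʳ j))) (boundedSeqs b N))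
cappedCount≡sum-𝟙 b N j = length-filter≡sum-𝟙 (λ v → ascending? (v Vec.∷ʳ j)) (boundedSeqs b N)

f≡∑cappedCount : ∀ b N → + f b N ≡ ∑[ a < suc (b N) ] (+ cappedCount b N a)
f≡∑cappedCount b N = begin
  + length (filter ascending? (boundedSeqs b (suc N)))
    ≡⟨ cong +_ (length-filter≡sum-𝟙 ascending? (boundedSeqs b (suc N))) ⟩
  + sum (map (𝟙 ∘ ascending?) (boundedSeqs b (suc N)))
    ≡⟨ cong +_ (sum-map-boundedSeqs-suc b N (𝟙 ∘ ascending?)) ⟩
  + sum (map (λ a → sum (map (λ v → 𝟙 (ascending? (v Vec.∷ʳ a))) (boundedSeqs b N))) as)
    ≡⟨ cong (λ l → + sum l) (List.map-cong (λ a → cappedCount≡sum-𝟙 b N a) as) ⟨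
  + sum (map (cappedCount b N) as)
    ≡⟨ sum-map-upTo (suc (b N)) (cappedCount b N) ⟩
  ∑[ a < suc (b N) ] (+ cappedCount b N a)
    ∎
  where
  open ≡-Reasoning
  as : List ℕ
  as = upTo (suc (b N))

cappedCount-suc : ∀ b N j →
  + cappedCount b (suc N) j ≡ ∑[ a < suc (b N) ] (+ 𝟙 (a ≤? j) * + cappedCount b N a)
cappedCount-suc b N j = begin
  + cappedCount b (suc N) j
    ≡⟨ cong +_ (cappedCount≡sum-𝟙 b (suc N) j) ⟩
  + sum (map (λ w → 𝟙 (ascending? (w Vec.∷ʳ j))) (boundedSeqs b (suc N)))
    ≡⟨ cong +_ (sum-map-boundedSeqs-suc b N (λ w → 𝟙 (ascending? (w Vec.∷ʳ j)))) ⟩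
  + sum (map (λ a → sum (map (λ v → 𝟙 (ascending? ((v Vec.∷ʳ a) Vec.∷ʳ j))) (boundedSeqs b N))) as)
    ≡⟨ cong (λ l → + sum l) (List.map-cong factor as) ⟩
  + sum (map (λ a → 𝟙 (a ≤? j) ℕ.* cappedCount b N a) as)
    ≡⟨ sum-map-upTo (suc (b N)) _ ⟩
  ∑[ a < suc (b N) ] (+ (𝟙 (a ≤? j) ℕ.* cappedCount b N a))
    ≡⟨ ∑-cong (suc (b N)) (λ a _ → ℤ.pos-* (𝟙 (a ≤? j)) (cappedCount b N a)) ⟩
  ∑[ a < suc (b N) ] (+ 𝟙 (a ≤? j) * + cappedCount b N a)
    ∎
  where
  open ≡-Reasoning
  as : List ℕ
  as = upTo (suc (b N))
  factor : ∀ a → sum (map (λ v → 𝟙 (ascending? ((v Vec.∷ʳ a) Vec.∷ʳ j))) (boundedSeqs b N))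
               ≡ 𝟙 (a ≤? j) ℕ.* cappedCount b N a
  factor a = begin
    sum (map (λ v → 𝟙 (ascending? ((v Vec.∷ʳ a) Vec.∷ʳ j))) (boundedSeqs b N))
      ≡⟨ cong sum (List.map-cong (λ v → 𝟙-ascending-∷ʳ-∷ʳ v a j) (boundedSeqs b N)) ⟩
    sum (map (λ v → 𝟙 (a ≤? j) ℕ.* 𝟙 (ascending? (v Vec.∷ʳ a))) (boundedSeqs b N))
      ≡⟨ *-distribˡ-sum-map (𝟙 (a ≤? j)) _ (boundedSeqs b N) ⟨
    𝟙 (a ≤? j) ℕ.* sum (map (λ v → 𝟙 (ascending? (v Vec.∷ʳ a))) (boundedSeqs b N))
      ≡⟨ cong (𝟙 (a ≤? j) ℕ.*_) (cappedCount≡sum-𝟙 b N a) ⟨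
    𝟙 (a ≤? j) ℕ.* cappedCount b N a
      ∎

theorem2 : (b : ℕ → ℕ) → (∀ i → b i ≤ b (suc i)) →
    ∀ k → one k ≡ ((oneMinusX ^ₚ suc (b 0))
      +ₚ sumSeries (λ n → (+ f b n) ·ₚ ((X ^ₚ suc n) *ₚ (oneMinusX ^ₚ suc (b (suc n)))))) k
theorem2 b b-mono =
  TransferIdentity.identity b b-mono (λ N j → + cappedCount b N j) (λ n → + f b n)
    (λ _ → refl) (cappedCount-suc b) (f≡∑cappedCount b)
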